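{- Let $S,T$ be sets of parametric vectors in $\mathbb{Z}[t]^m$ such that (1) all elements of $S$ have the same degree and all elements of $T$ have the same degree; (2) the set of pilot vectors $\widetilde{S}$ is linearly independent, and so is $\widetilde{T}$; and (3) $S\perp^{asym}T$. Then $\operatorname{Span}_{\mathbb{Z}}(S)\perp^{asym}\operatorname{Span}_{\mathbb{Z}}(T)$.
   Context: For $\mathbf{f}\in\mathbb{Z}[t]^m$, $\deg\mathbf{f}$ is the maximum degree of its coordinates and its pilot vector $\widetilde{\mathbf{f}}\in\mathbb{Z}^m$ is the vector of coefficients of $t^{\deg\mathbf{f}}$. Two parametric vectors are asymptotically orthogonal if their pilot vectors are orthogonal; $A\perp^{asym}B$ means every element of $A$ is asymptotically orthogonal to every element of $B$. -}

module Defs where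

open import Data.Nat using (ℕ; zero; suc)
open import Data.Integer using (ℤ; 0ℤ; _+_; _*_)
open import Data.Integer.Properties using (_≟_)
open import Data.Fin using (Fin; zero; suc)
open import Data.List using (List; []; _∷_)
open import Data.Vec using (Vec; []; _∷_; zipWith; replicate; map; foldr)
open import Data.Maybe using (Maybe; just; nothing; maybe)
open import Data.Product using (_×_; _,_; proj₁; proj₂)
open import Data.Bool using (Bool; true; false; if_then_else_; _∧_)
open import Relation.Nullary.Decidable using (⌊_⌋)
open import Relation.Binary.PropositionalEquality using (_≡_)

zeroV : ∀ {m} → Vec ℤ m
zeroV = replicate _ 0ℤ

_+V_ : ∀ {m} → Vec ℤ m → Vec ℤ m → Vec ℤ m
_+V_ = zipWith _+_

_·V_ : ∀ {m} → ℤ → Vec ℤ m → Vec ℤ m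
c ·V v = map (c *_) v

dot : ∀ {m} → Vec ℤ m → Vec ℤ m → ℤ
dot u v = foldr _ _+_ 0ℤ (zipWith _*_ u v)

isZeroV : ∀ {m} → Vec ℤ m → Bool
isZeroV [] = true
isZeroV (x ∷ v) = ⌊ x ≟ 0ℤ ⌋ ∧ isZeroV v

-- A parametric vector f ∈ ℤ[t]^m, written f = Σ_k c_k t^k, is represented by
-- its list of coefficient vectors [c_0, c_1, ...] (trailing zeros allowed).
PVec : ℕ → Set
PVec m = List (Vec ℤ m)

_+P_ : ∀ {m} → PVec m → PVec m → PVec m
[] +P g = g
(c ∷ f) +P [] = c ∷ f
(c ∷ f) +P (d ∷ g) = (c +V d) ∷ (f +P g)

_·P_ : ∀ {m} → ℤ → PVec m → PVec m
a ·P [] = []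
a ·P (c ∷ f) = (a ·V c) ∷ (a ·P f)

zeroP : ∀ {m} → PVec m
zeroP = []

-- leading data: (degree, coefficient vector of t^degree), nothing for f = 0
lead : ∀ {m} → PVec m → Maybe (ℕ × Vec ℤ m)
lead [] = nothing
lead (c ∷ f) with lead f
... | just (d , v) = just (suc d , v)
... | nothing = if isZeroV c then nothing else just (0 , c)

-- deg f = max degree of coordinates (convention: deg 0 = 0, never used)
deg : ∀ {m} → PVec m → ℕ
deg f = maybe proj₁ 0 (lead f)

pilot : ∀ {m} → PVec m → Vec ℤ m
pilot f = maybe proj₂ zeroV (lead f)

AsymOrth : ∀ {m} → PVec m → PVec m → Set
AsymOrth f g = dot (pilot f) (pilot g) ≡ 0ℤ

sumFin : ∀ {k} {A : Set} → A → (A → A → A) → (Fin k → A) → A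
sumFin {zero} e _⊕_ f = e
sumFin {suc k} e _⊕_ f = f zero ⊕ sumFin e _⊕_ (λ i → f (suc i))

lincombV : ∀ {m k} → (Fin k → ℤ) → (Fin k → Vec ℤ m) → Vec ℤ m
lincombV c v = sumFin zeroV _+V_ (λ i → c i ·V v i)

lincombP : ∀ {m k} → (Fin k → ℤ) → (Fin k → PVec m) → PVec m
lincombP c S = sumFin zeroP _+P_ (λ i → c i ·P S i)

LinIndep : ∀ {m k} → (Fin k → Vec ℤ m) → Set
LinIndep {k = k} v = (c : Fin k → ℤ) → lincombV c v ≡ zeroV → (i : Fin k) → c i ≡ 0ℤ

SameDeg : ∀ {m k} → (Fin k → PVec m) → Set
SameDeg {k = k} S = (i j : Fin k) → deg (S i) ≡ deg (S j)

FamAsymOrth : ∀ {m k l} → (Fin k → PVec m) → (Fin l → PVec m) → Set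
FamAsymOrth {k = k} {l = l} S T = (i : Fin k) (j : Fin l) → AsymOrth (S i) (T j)

module Submission where

-- The leading coefficient of a ℤ-combination of parametric vectors of a common degree d is
-- the same combination of their pilots, unless that combination vanishes; by linear
-- independence of the pilots it then vanishes only when every coefficient is zero, and so
-- does the whole combination.  Hence pilot (Σ aᵢ Sᵢ) = Σ aᵢ pilot Sᵢ on both sides, and the
-- claim reduces to bilinearity of the dot product.

open import Defs
open import Data.Nat using (ℕ; zero; suc; _<_; s≤s)
open import Data.Nat.Properties using (<-cmp)
open import Data.Integer using (ℤ; 0ℤ; _+_; _*_)
open import Data.Integer.Properties
  using (_≟_; +-identityˡ; +-identityʳ; *-zeroʳ; *-zeroˡ; *-comm)
open import Data.Integer.Tactic.RingSolver using (solve-∀)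
open import Data.Fin using (Fin; zero; suc)
open import Data.List using ([]; _∷_)
open import Data.Vec using (Vec; []; _∷_; replicate)
open import Data.Vec.Properties
  using (≡-dec; zipWith-identityˡ; zipWith-identityʳ; map-replicate; map-cong; map-const)
open import Data.Maybe using (just; nothing)
open import Data.Product using (_×_; _,_; proj₁; proj₂)
open import Data.Bool using (true; false)
open import Function using (_∘_)
open import Relation.Nullary using (yes; no; contradiction)
open import Relation.Binary.Definitions using (tri<; tri≈; tri>)
open import Relation.Binary.PropositionalEquality

module _ {A : Set} {e : A} {_⊕_ : A → A → A} where

  sumFin-cong : ∀ {k} {f g : Fin k → A} → (∀ i → f i ≡ g i) → sumFin e _⊕_ f ≡ sumFin e _⊕_ g
  sumFin-cong {zero} f≗g = refl
  sumFin-cong {suc k} f≗g = cong₂ _⊕_ (f≗g zero) (sumFin-cong (f≗g ∘ suc))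

  sumFin-const-e : e ⊕ e ≡ e → ∀ {k} {f : Fin k → A} → (∀ i → f i ≡ e) → sumFin e _⊕_ f ≡ e
  sumFin-const-e e⊕e {zero} f≡e = refl
  sumFin-const-e e⊕e {suc k} f≡e =
    trans (cong₂ _⊕_ (f≡e zero) (sumFin-const-e e⊕e (f≡e ∘ suc))) e⊕e

  sumFin-homo : ∀ {B : Set} {e′ : B} {_⊕′_ : B → B → B} (h : A → B) →
    h e ≡ e′ → (∀ x y → h (x ⊕ y) ≡ h x ⊕′ h y) →
    ∀ {k} (f : Fin k → A) → h (sumFin e _⊕_ f) ≡ sumFin e′ _⊕′_ (h ∘ f)
  sumFin-homo h h-e h-⊕ {zero} f = h-e
  sumFin-homo {_⊕′_ = _⊕′_} h h-e h-⊕ {suc k} f =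
    trans (h-⊕ (f zero) _) (cong (h (f zero) ⊕′_) (sumFin-homo h h-e h-⊕ (f ∘ suc)))

+V-identityˡ : ∀ {m} (v : Vec ℤ m) → zeroV +V v ≡ v
+V-identityˡ = zipWith-identityˡ +-identityˡ

+V-identityʳ : ∀ {m} (v : Vec ℤ m) → v +V zeroV ≡ v
+V-identityʳ = zipWith-identityʳ +-identityʳ

·V-zeroʳ : ∀ {m} (a : ℤ) → a ·V zeroV {m} ≡ zeroV
·V-zeroʳ {m} a = trans (map-replicate (a *_) 0ℤ m) (cong (replicate m) (*-zeroʳ a))

·V-zeroˡ : ∀ {m} (v : Vec ℤ m) → 0ℤ ·V v ≡ zeroV
·V-zeroˡ v = trans (map-cong *-zeroˡ v) (map-const v 0ℤ)

lincombV-cong : ∀ {m k} (a : Fin k → ℤ) {u w : Fin k → Vec ℤ m} →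
  (∀ i → u i ≡ w i) → lincombV a u ≡ lincombV a w
lincombV-cong a u≗w = sumFin-cong (λ i → cong (a i ·V_) (u≗w i))

lincombV-zeroʳ : ∀ {m k} (a : Fin k → ℤ) {u : Fin k → Vec ℤ m} →
  (∀ i → u i ≡ zeroV) → lincombV a u ≡ zeroV
lincombV-zeroʳ a u≡0 =
  sumFin-const-e (+V-identityˡ zeroV) (λ i → trans (cong (a i ·V_) (u≡0 i)) (·V-zeroʳ (a i)))

lincombV-zeroˡ : ∀ {m k} {a : Fin k → ℤ} (u : Fin k → Vec ℤ m) →
  (∀ i → a i ≡ 0ℤ) → lincombV a u ≡ zeroV
lincombV-zeroˡ u a≡0 =
  sumFin-const-e (+V-identityˡ zeroV) (λ i → trans (cong (_·V u i) (a≡0 i)) (·V-zeroˡ (u i)))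

dot-zeroˡ : ∀ {m} (w : Vec ℤ m) → dot zeroV w ≡ 0ℤ
dot-zeroˡ [] = refl
dot-zeroˡ (x ∷ w) = trans (cong (0ℤ * x +_) (dot-zeroˡ w)) refl

dot-distribʳ-+V : ∀ {m} (u v w : Vec ℤ m) → dot (u +V v) w ≡ dot u w + dot v w
dot-distribʳ-+V [] [] [] = refl
dot-distribʳ-+V (a ∷ u) (b ∷ v) (c ∷ w) =
  trans (cong ((a + b) * c +_) (dot-distribʳ-+V u v w)) (regroup a b c (dot u w) (dot v w))
  where
  regroup : ∀ a b c p q → (a + b) * c + (p + q) ≡ (a * c + p) + (b * c + q)
  regroup = solve-∀

dot-·V : ∀ {m} (a : ℤ) (v w : Vec ℤ m) → dot (a ·V v) w ≡ a * dot v w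
dot-·V a [] [] = sym (*-zeroʳ a)
dot-·V a (b ∷ v) (c ∷ w) =
  trans (cong (a * b * c +_) (dot-·V a v w)) (factor a b c (dot v w))
  where
  factor : ∀ a b c p → a * b * c + a * p ≡ a * (b * c + p)
  factor = solve-∀

dot-comm : ∀ {m} (v w : Vec ℤ m) → dot v w ≡ dot w v
dot-comm [] [] = refl
dot-comm (a ∷ v) (b ∷ w) = cong₂ _+_ (*-comm a b) (dot-comm v w)

lincombV-orthˡ : ∀ {m k} (a : Fin k → ℤ) (u : Fin k → Vec ℤ m) (w : Vec ℤ m) →
  (∀ i → dot (u i) w ≡ 0ℤ) → dot (lincombV a u) w ≡ 0ℤ
lincombV-orthˡ a u w u⊥w =
  trans (sumFin-homo {_⊕′_ = _+_} (λ x → dot x w) (dot-zeroˡ w) (λ x y → dot-distribʳ-+V x y w)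
                      (λ i → a i ·V u i))
        (sumFin-const-e refl (λ i →
          trans (dot-·V (a i) (u i) w) (trans (cong (a i *_) (u⊥w i)) (*-zeroʳ (a i)))))

lincombV-orth : ∀ {m k l} (a : Fin k → ℤ) (b : Fin l → ℤ)
  (u : Fin k → Vec ℤ m) (w : Fin l → Vec ℤ m) →
  (∀ i j → dot (u i) (w j) ≡ 0ℤ) → dot (lincombV a u) (lincombV b w) ≡ 0ℤ
lincombV-orth a b u w u⊥w = lincombV-orthˡ a u _ λ i →
  trans (dot-comm (u i) _) (lincombV-orthˡ b w (u i) λ j → trans (dot-comm (w j) _) (u⊥w i j))

isZeroV-true : ∀ {m} (v : Vec ℤ m) → isZeroV v ≡ true → v ≡ zeroV
isZeroV-true [] _ = refl
isZeroV-true (x ∷ v) p with x ≟ 0ℤ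
... | yes refl = cong (0ℤ ∷_) (isZeroV-true v p)

isZeroV-zeroV : ∀ {m} → isZeroV (zeroV {m}) ≡ true
isZeroV-zeroV {zero} = refl
isZeroV-zeroV {suc m} = isZeroV-zeroV {m}

isZeroV-false : ∀ {m} (v : Vec ℤ m) → isZeroV v ≡ false → v ≢ zeroV
isZeroV-false {m} v p v≡0 with () ← trans (sym (trans (cong isZeroV v≡0) (isZeroV-zeroV {m}))) p

coeff : ∀ {m} → PVec m → ℕ → Vec ℤ m
coeff [] n = zeroV
coeff (c ∷ f) zero = c
coeff (c ∷ f) (suc n) = coeff f n

coeff-+P : ∀ {m} (f g : PVec m) n → coeff (f +P g) n ≡ coeff f n +V coeff g n
coeff-+P [] g n = sym (+V-identityˡ (coeff g n))
coeff-+P (c ∷ f) [] n = sym (+V-identityʳ (coeff (c ∷ f) n))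
coeff-+P (c ∷ f) (d ∷ g) zero = refl
coeff-+P (c ∷ f) (d ∷ g) (suc n) = coeff-+P f g n

coeff-·P : ∀ {m} (a : ℤ) (f : PVec m) n → coeff (a ·P f) n ≡ a ·V coeff f n
coeff-·P a [] n = sym (·V-zeroʳ a)
coeff-·P a (c ∷ f) zero = refl
coeff-·P a (c ∷ f) (suc n) = coeff-·P a f n

coeff-lincombP : ∀ {m k} (a : Fin k → ℤ) (S : Fin k → PVec m) n →
  coeff (lincombP a S) n ≡ lincombV a (λ i → coeff (S i) n)
coeff-lincombP a S n =
  trans (sumFin-homo {_⊕′_ = _+V_} (λ f → coeff f n) refl (λ f g → coeff-+P f g n)
                      (λ i → a i ·P S i))
        (sumFin-cong (λ i → coeff-·P (a i) (S i) n))

HasTop : ∀ {m} → ℕ → Vec ℤ m → PVec m → Set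
HasTop d v f = coeff f d ≡ v × (∀ n → d < n → coeff f n ≡ zeroV)

top-unique : ∀ {m} (f : PVec m) {d e v w} → HasTop d v f → HasTop e w f →
  v ≢ zeroV → w ≢ zeroV → v ≡ w
top-unique f {d} {e} (fd≡v , above-d) (fe≡w , above-e) v≢0 w≢0 with <-cmp d e
... | tri< d<e _ _ = contradiction (trans (sym fe≡w) (above-d e d<e)) w≢0
... | tri≈ _ refl _ = trans (sym fd≡v) fe≡w
... | tri> _ _ e<d = contradiction (trans (sym fd≡v) (above-e d e<d)) v≢0

lead-nothing : ∀ {m} (f : PVec m) → lead f ≡ nothing → ∀ n → coeff f n ≡ zeroV
lead-nothing [] _ n = refl
lead-nothing (c ∷ f) p n with lead f in eq
lead-nothing (c ∷ f) p n | nothing with isZeroV c in c≡0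
lead-nothing (c ∷ f) p zero | nothing | true = isZeroV-true c c≡0
lead-nothing (c ∷ f) p (suc n) | nothing | true = lead-nothing f eq n

lead-just : ∀ {m} (f : PVec m) {e w} → lead f ≡ just (e , w) → HasTop e w f × w ≢ zeroV
lead-just (c ∷ f) p with lead f in eq
lead-just (c ∷ f) refl | just (d , v) with lead-just f eq
... | (fd≡v , above-d) , v≢0 = (fd≡v , λ { (suc n) (s≤s d<n) → above-d n d<n }) , v≢0
lead-just (c ∷ f) p | nothing with isZeroV c in c≢0
lead-just (c ∷ f) refl | nothing | false =
  (refl , λ { (suc n) _ → lead-nothing f eq n }) , isZeroV-false c c≢0

hasTop-pilot : ∀ {m} (f : PVec m) → HasTop (deg f) (pilot f) f
hasTop-pilot f with lead f in eq
... | nothing = lead-nothing f eq 0 , λ n _ → lead-nothing f eq n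
... | just _ = proj₁ (lead-just f eq)

pilot-unique : ∀ {m} (f : PVec m) {d v} → HasTop d v f → v ≢ zeroV → pilot f ≡ v
pilot-unique f {d} top v≢0 with lead f in eq
... | nothing = contradiction (trans (sym (proj₁ top)) (lead-nothing f eq d)) v≢0
... | just _ = let top′ , w≢0 = lead-just f eq in top-unique f top′ top w≢0 v≢0

pilot-vanishing : ∀ {m} (f : PVec m) → (∀ n → coeff f n ≡ zeroV) → pilot f ≡ zeroV
pilot-vanishing f f≡0 = trans (sym (proj₁ (hasTop-pilot f))) (f≡0 (deg f))

pilot-lincombP-at : ∀ {m k} (d : ℕ) (S : Fin k → PVec m) (a : Fin k → ℤ) →
  (∀ i → HasTop d (pilot (S i)) (S i)) → LinIndep (λ i → pilot (S i)) →
  pilot (lincombP a S) ≡ lincombV a (λ i → pilot (S i))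
pilot-lincombP-at d S a tops indep with ≡-dec _≟_ (lincombV a (λ i → pilot (S i))) zeroV
... | yes v≡0 = trans (pilot-vanishing (lincombP a S) λ n →
        trans (coeff-lincombP a S n) (lincombV-zeroˡ _ (indep a v≡0))) (sym v≡0)
... | no v≢0 = pilot-unique (lincombP a S) (top , above) v≢0
  where
  top = trans (coeff-lincombP a S d) (lincombV-cong a (proj₁ ∘ tops))
  above = λ n d<n → trans (coeff-lincombP a S n) (lincombV-zeroʳ a (λ i → proj₂ (tops i) n d<n))

pilot-lincombP : ∀ {m k} (S : Fin k → PVec m) (a : Fin k → ℤ) →
  SameDeg S → LinIndep (λ i → pilot (S i)) →
  pilot (lincombP a S) ≡ lincombV a (λ i → pilot (S i))
pilot-lincombP {k = zero} S a _ _ = refl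
pilot-lincombP {k = suc k} S a same indep = pilot-lincombP-at (deg (S zero)) S a
  (λ i → subst (λ d → HasTop d (pilot (S i)) (S i)) (same i zero) (hasTop-pilot (S i))) indep

lemma3p21 : (m k l : ℕ) (S : Fin k → PVec m) (T : Fin l → PVec m) →
    SameDeg S → SameDeg T →
    LinIndep (λ i → pilot (S i)) → LinIndep (λ j → pilot (T j)) →
    FamAsymOrth S T →
    (a : Fin k → ℤ) (b : Fin l → ℤ) → AsymOrth (lincombP a S) (lincombP b T)
lemma3p21 m k l S T sameS sameT indepS indepT S⊥T a b =
  trans (cong₂ dot (pilot-lincombP S a sameS indepS) (pilot-lincombP T b sameT indepT))
        (lincombV-orth a b _ _ S⊥T)
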